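{- $\gamma(3)=8$.
   Context: An occurrence of a word $C$ as a subsequence of a word $S$ is an increasing sequence of positions $i_0<\cdots<i_{|C|-1}$ of $S$ with $S[i_j]=C[j]$. $C$ is an s-cover of $S$ if every position of $S$ lies in some occurrence of $C$ as a subsequence of $S$. An s-cover $C$ of $S$ is non-trivial if $|C|<|S|$; $S$ is s-primitive if it has no non-trivial s-cover. $\gamma(k)$ denotes the length of a longest s-primitive word over an alphabet of size $k$. -}

module Defs where

open import Data.Nat using (ℕ; _<_; _≤_)
open import Data.Fin using (Fin; toℕ) renaming (_<_ to _<ᶠ_)
open import Data.List using (List; length; lookup)
open import Data.Product using (Σ; ∃; _×_; _,_)
open import Relation.Binary.PropositionalEquality using (_≡_)
open import Relation.Nullary using (¬_)

Word : ℕ → Set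
Word k = List (Fin k)

record Occurrence {k : ℕ} (C S : Word k) : Set where
  field
    pos        : Fin (length C) → Fin (length S)
    increasing : ∀ (i j : Fin (length C)) → i <ᶠ j → pos i <ᶠ pos j
    matches    : ∀ (i : Fin (length C)) → lookup S (pos i) ≡ lookup C i

IsSCover : {k : ℕ} → Word k → Word k → Set
IsSCover C S = ∀ (p : Fin (length S)) →
  Σ (Occurrence C S) λ o → ∃ λ (i : Fin (length C)) → Occurrence.pos o i ≡ p

IsSPrimitive : {k : ℕ} → Word k → Set
IsSPrimitive {k} S = ∀ (C : Word k) → length C < length S → ¬ IsSCover C S

IsGamma : ℕ → ℕ → Set
IsGamma k n =
  (Σ (Word k) λ S → IsSPrimitive S × length S ≡ n) ×
  (∀ (S : Word k) → IsSPrimitive S → length S ≤ n)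

{-# OPTIONS --safe #-}
-- Every s-cover of S is a subsequence of S, and whether a given subsequence covers S is a
-- finite check, so having a nontrivial s-cover is decidable.  It is also inherited by
-- extensions: if C covers F then C ++ u covers F ++ u.  Hence every word of length 9 over
-- three letters is shown to be non-s-primitive by a finite search that stops at the first
-- prefix with a nontrivial cover; since renaming letters preserves covers, only words
-- starting with ab need to be searched (aa is covered by a).  The lower bound is the same
-- decision procedure run on abcabacb.
module Submission where

open import Defs
open import Data.Empty using (⊥)
open import Data.Unit using (⊤; tt)
open import Data.Fin as Fin using (Fin; zero; suc; toℕ; fromℕ<) renaming (_<_ to _<ᶠ_; _≤_ to _≤ᶠ_)
open import Data.Fin.Properties using (toℕ-injective; toℕ<n; toℕ-fromℕ<; toℕ-cast; all?)
open import Data.Fin.Permutation.Components using (transpose; transpose-inverse)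
open import Data.List as List using (List; []; _∷_; length; lookup; _++_; [_])
open import Data.List.Properties using (length-++; ++-assoc; length-map; map-∘; map-cong; map-id)
open import Data.List.Relation.Binary.Sublist.Propositional using (_⊆_; []; _∷_; _∷ʳ_; ⊆-refl; minimum)
open import Data.List.Relation.Binary.Sublist.Propositional.Properties using (++⁺; map⁺)
import Data.List.Relation.Binary.Sublist.DecPropositional as DecSublist
open import Data.Nat using (ℕ; zero; suc; _+_; _∸_; _<_; _≤_; z≤n; s≤s; s<s⁻¹; _<?_)
open import Data.Nat.Properties using (≤-refl; <⇒≤; <-≤-trans; ≮⇒≥; m+[n∸m]≡n; +-monoˡ-<; +-cancelˡ-<)
open import Data.Product using (Σ; ∃; _×_; _,_; proj₁; proj₂; map; map₂)
open import Data.Sum using (_⊎_; inj₁; inj₂)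
open import Function using (_∘_; _$_; id)
open import Level using (Level)
open import Relation.Binary.PropositionalEquality using (_≡_; refl; sym; trans; cong; subst; subst₂; module ≡-Reasoning)
open import Relation.Nullary using (¬_; Dec; yes; no)
open import Relation.Nullary.Decidable using (map′; _×-dec_; _⊎-dec_; ¬?; toWitness)
open import Relation.Unary using (Pred; Decidable)

open Occurrence
open ≡-Reasoning

private
  variable
    ℓ : Level
    k n p : ℕ
    c y : Fin k
    C D F G S w : Word k

-- Positions are natural numbers here, so that positions of F ++ G need no casts.
Hits : C ⊆ S → ℕ → Set
Hits []       _       = ⊥
Hits (_ ∷ʳ τ) zero    = ⊥
Hits (_ ∷ʳ τ) (suc p) = Hits τ p
Hits (_ ∷ τ)  zero    = ⊤
Hits (_ ∷ τ)  (suc p) = Hits τ p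

Covered : Word k → Word k → ℕ → Set
Covered C S p = Σ (C ⊆ S) λ τ → Hits τ p

Covers : Word k → Word k → Set
Covers C S = ∀ (p : Fin (length S)) → Covered C S (toℕ p)

covers-at : Covers C S → p < length S → Covered C S p
covers-at {C = C} {S = S} cover p<S = subst (Covered C S) (toℕ-fromℕ< p<S) (cover (fromℕ< p<S))

covers⇒⊆ : Covers C (y ∷ S) → C ⊆ y ∷ S
covers⇒⊆ cover = proj₁ (cover zero)

position : C ⊆ S → Fin (length C) → Fin (length S)
position (_ ∷ʳ τ) i       = suc (position τ i)
position (_ ∷ τ)  zero    = zero
position (_ ∷ τ)  (suc i) = suc (position τ i)

position-increasing : (τ : C ⊆ S) → ∀ i j → i <ᶠ j → position τ i <ᶠ position τ j
position-increasing (_ ∷ʳ τ) i       j       i<j       = s≤s (position-increasing τ i j i<j)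
position-increasing (_ ∷ τ)  zero    (suc j) _         = s≤s z≤n
position-increasing (_ ∷ τ)  (suc i) (suc j) (s≤s i<j) = s≤s (position-increasing τ i j i<j)

position-matches : (τ : C ⊆ S) → ∀ i → lookup S (position τ i) ≡ lookup C i
position-matches (_ ∷ʳ τ)   i       = position-matches τ i
position-matches (refl ∷ τ) zero    = refl
position-matches (_ ∷ τ)    (suc i) = position-matches τ i

⊆⇒occurrence : C ⊆ S → Occurrence C S
⊆⇒occurrence τ = record
  { pos        = position τ
  ; increasing = position-increasing τ
  ; matches    = position-matches τ
  }

hits⇒position : (τ : C ⊆ S) → Hits τ p → ∃ λ i → toℕ (position τ i) ≡ p
hits⇒position {p = suc p} (_ ∷ʳ τ) h = map₂ (cong suc) (hits⇒position τ h)
hits⇒position {p = zero}  (_ ∷ τ)  _ = zero , refl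
hits⇒position {p = suc p} (_ ∷ τ)  h = map suc (cong suc) (hits⇒position τ h)

Covers⇒IsSCover : Covers C S → IsSCover C S
Covers⇒IsSCover cover p with cover p
... | τ , h with hits⇒position τ h
...   | i , i↦p = ⊆⇒occurrence τ , i , toℕ-injective i↦p

suc⁻¹ : (j : Fin (suc n)) → 0 < toℕ j → Fin n
suc⁻¹ (suc j) _ = j

toℕ-suc⁻¹ : (j : Fin (suc n)) (0<j : 0 < toℕ j) → toℕ j ≡ suc (toℕ (suc⁻¹ j 0<j))
toℕ-suc⁻¹ (suc j) _ = refl

suc⁻¹-increasing : (i j : Fin (suc n)) (0<i : 0 < toℕ i) (0<j : 0 < toℕ j) →
                   i <ᶠ j → suc⁻¹ i 0<i <ᶠ suc⁻¹ j 0<j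
suc⁻¹-increasing (suc i) (suc j) _ _ i<j = s<s⁻¹ i<j

lookup-suc⁻¹ : (j : Fin (suc (length S))) (0<j : 0 < toℕ j) →
               lookup S (suc⁻¹ j 0<j) ≡ lookup (y ∷ S) j
lookup-suc⁻¹ (suc j) _ = refl

occurrence-∷ʳ⁻ : (o : Occurrence C (y ∷ S)) → (∀ i → 0 < toℕ (pos o i)) → Occurrence C S
occurrence-∷ʳ⁻ o 0<pos = record
  { pos        = λ i → suc⁻¹ (pos o i) (0<pos i)
  ; increasing = λ i j i<j → suc⁻¹-increasing _ _ (0<pos i) (0<pos j) (increasing o i j i<j)
  ; matches    = λ i → trans (lookup-suc⁻¹ (pos o i) (0<pos i)) (matches o i)
  }

occurrence-tail : Occurrence (c ∷ C) S → Occurrence C S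
occurrence-tail o = record
  { pos        = λ i → pos o (suc i)
  ; increasing = λ i j i<j → increasing o (suc i) (suc j) (s≤s i<j)
  ; matches    = λ i → matches o (suc i)
  }

first-position-least : (o : Occurrence (c ∷ C) S) → ∀ i → pos o zero ≤ᶠ pos o i
first-position-least o zero    = ≤-refl
first-position-least o (suc i) = <⇒≤ (increasing o zero (suc i) (s≤s z≤n))

occurrence⇒⊆ : (o : Occurrence C S) → Σ (C ⊆ S) λ τ → ∀ i → Hits τ (toℕ (pos o i))
occurrence⇒⊆ {C = []}    {S = S}     o = minimum S , λ ()
occurrence⇒⊆ {C = c ∷ C} {S = []}    o with pos o zero
... | ()
occurrence⇒⊆ {C = c ∷ C} {S = y ∷ S} o with pos o zero in first
... | zero  = c≡y ∷ τ , hits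
  where
  0<pos : ∀ i → 0 < toℕ (pos o (suc i))
  0<pos i = subst (_<ᶠ pos o (suc i)) first (increasing o zero (suc i) (s≤s z≤n))
  c≡y : c ≡ y
  c≡y = sym (subst (λ j → lookup (y ∷ S) j ≡ c) first (matches o zero))
  rest : Σ (C ⊆ S) λ τ → ∀ i → Hits τ (toℕ (suc⁻¹ (pos o (suc i)) (0<pos i)))
  rest = occurrence⇒⊆ (occurrence-∷ʳ⁻ (occurrence-tail o) 0<pos)
  τ : C ⊆ S
  τ = proj₁ rest
  hits : ∀ i → Hits (c≡y ∷ τ) (toℕ (pos o i))
  hits zero    = subst (Hits (c≡y ∷ τ)) (sym (cong toℕ first)) tt
  hits (suc i) = subst (Hits (c≡y ∷ τ)) (sym (toℕ-suc⁻¹ _ (0<pos i))) (proj₂ rest i)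
... | suc _ = y ∷ʳ τ , hits
  where
  0<pos : ∀ i → 0 < toℕ (pos o i)
  0<pos i = <-≤-trans (subst (λ j → 0 < toℕ j) (sym first) (s≤s z≤n))
                      (first-position-least o i)
  rest : Σ (c ∷ C ⊆ S) λ τ → ∀ i → Hits τ (toℕ (suc⁻¹ (pos o i) (0<pos i)))
  rest = occurrence⇒⊆ (occurrence-∷ʳ⁻ o 0<pos)
  τ : c ∷ C ⊆ S
  τ = proj₁ rest
  hits : ∀ i → Hits (y ∷ʳ τ) (toℕ (pos o i))
  hits i = subst (Hits (y ∷ʳ τ)) (sym (toℕ-suc⁻¹ _ (0<pos i))) (proj₂ rest i)

IsSCover⇒Covers : IsSCover C S → Covers C S
IsSCover⇒Covers cover p with cover p
... | o , i , refl = map₂ (_$ i) (occurrence⇒⊆ o)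

Hits-⊆-refl : (S : Word k) → p < length S → Hits (⊆-refl {x = S}) p
Hits-⊆-refl {p = zero}  (_ ∷ S) _   = tt
Hits-⊆-refl {p = suc p} (_ ∷ S) p<S = Hits-⊆-refl S (s<s⁻¹ p<S)

Covers-refl : Covers S S
Covers-refl {S = S} p = ⊆-refl {x = S} , Hits-⊆-refl S (toℕ<n p)

Hits-++⁺ˡ : (τ : C ⊆ F) (σ : D ⊆ G) → Hits τ p → Hits (++⁺ τ σ) p
Hits-++⁺ˡ {p = suc p} (_ ∷ʳ τ) σ h = Hits-++⁺ˡ τ σ h
Hits-++⁺ˡ {p = zero}  (_ ∷ τ)  σ h = h
Hits-++⁺ˡ {p = suc p} (_ ∷ τ)  σ h = Hits-++⁺ˡ τ σ h

Hits-++⁺ʳ : (τ : C ⊆ F) (σ : D ⊆ G) → Hits σ p → Hits (++⁺ τ σ) (length F + p)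
Hits-++⁺ʳ []       σ h = h
Hits-++⁺ʳ (_ ∷ʳ τ) σ h = Hits-++⁺ʳ τ σ h
Hits-++⁺ʳ (_ ∷ τ)  σ h = Hits-++⁺ʳ τ σ h

Covers-++ : C ⊆ F → D ⊆ G → Covers C F → Covers D G → Covers (C ++ D) (F ++ G)
Covers-++ {C = C} {F = F} {D = D} {G = G} τ σ coverF coverG p =
  covered (toℕ p) (subst (toℕ p <_) (length-++ F) (toℕ<n p))
  where
  covered : ∀ q → q < length F + length G → Covered (C ++ D) (F ++ G) q
  covered q q<F+G with q <? length F
  ... | yes q<F = let τ′ , h = covers-at coverF q<F in ++⁺ τ′ σ , Hits-++⁺ˡ τ′ σ h
  ... | no  q≮F = subst (Covered (C ++ D) (F ++ G)) (m+[n∸m]≡n F≤q)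
                        (++⁺ τ σ′ , Hits-++⁺ʳ τ σ′ h)
    where
    F≤q : length F ≤ q
    F≤q = ≮⇒≥ q≮F
    q∸F<G : q ∸ length F < length G
    q∸F<G = +-cancelˡ-< (length F) _ _
              (subst (_< length F + length G) (sym (m+[n∸m]≡n F≤q)) q<F+G)
    σ′ : D ⊆ G
    σ′ = proj₁ (covers-at coverG q∸F<G)
    h : Hits σ′ (q ∸ length F)
    h = proj₂ (covers-at coverG q∸F<G)

Hits-map⁺ : (f : Fin k → Fin n) (τ : C ⊆ S) → Hits τ p → Hits (map⁺ f τ) p
Hits-map⁺ {p = suc p} f (_ ∷ʳ τ) h = Hits-map⁺ f τ h
Hits-map⁺ {p = zero}  f (_ ∷ τ)  h = h
Hits-map⁺ {p = suc p} f (_ ∷ τ)  h = Hits-map⁺ f τ h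

Covers-map : (f : Fin k → Fin n) → Covers C S → Covers (List.map f C) (List.map f S)
Covers-map {S = S} f cover p =
  let τ , h = cover (Fin.cast (length-map f S) p)
  in  map⁺ f τ , subst (Hits (map⁺ f τ)) (toℕ-cast (length-map f S) p) (Hits-map⁺ f τ h)

HasNontrivialCover : Word k → Set
HasNontrivialCover S = Σ (Word _) λ C → length C < length S × Covers C S

IsSPrimitive⇒¬HasNontrivialCover : IsSPrimitive S → ¬ HasNontrivialCover S
IsSPrimitive⇒¬HasNontrivialCover prim (C , C<S , cover) = prim C C<S (Covers⇒IsSCover cover)

¬HasNontrivialCover⇒IsSPrimitive : ¬ HasNontrivialCover S → IsSPrimitive S
¬HasNontrivialCover⇒IsSPrimitive ¬cover C C<S cover = ¬cover (C , C<S , IsSCover⇒Covers cover)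

HasNontrivialCover-++ : ∀ u → HasNontrivialCover F → HasNontrivialCover (F ++ u)
HasNontrivialCover-++ {F = []}    u (_ , () , _)
HasNontrivialCover-++ {F = y ∷ F} u (C , C<F , cover) =
  C ++ u , C++u<F++u , Covers-++ (covers⇒⊆ cover) (⊆-refl {x = u}) cover Covers-refl
  where
  C++u<F++u : length (C ++ u) < length (y ∷ F ++ u)
  C++u<F++u = subst₂ _<_ (sym (length-++ C)) (sym (length-++ (y ∷ F))) (+-monoˡ-< (length u) C<F)

HasNontrivialCover-map : (f : Fin k → Fin n) →
                         HasNontrivialCover S → HasNontrivialCover (List.map f S)
HasNontrivialCover-map {S = S} f (C , C<S , cover) =
  List.map f C , subst₂ _<_ (sym (length-map f C)) (sym (length-map f S)) C<S , Covers-map f cover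

HasNontrivialCover-transpose⁻ : ∀ (i j : Fin k) →
  HasNontrivialCover (List.map (transpose i j) S) → HasNontrivialCover S
HasNontrivialCover-transpose⁻ {S = S} i j h =
  subst HasNontrivialCover transpose-back (HasNontrivialCover-map (transpose j i) h)
  where
  transpose-back : List.map (transpose j i) (List.map (transpose i j) S) ≡ S
  transpose-back = begin
    List.map (transpose j i) (List.map (transpose i j) S)
      ≡⟨ map-∘ S ⟨
    List.map (transpose j i ∘ transpose i j) S
      ≡⟨ map-cong (λ _ → transpose-inverse j i) S ⟩
    List.map id S
      ≡⟨ map-id S ⟩
    S ∎

covered? : ∀ (C S : Word k) p → Dec (Covered C S p)
covered? C       []      p       = no λ { ([] , ()) }
covered? []      (y ∷ S) zero    = no λ { (_ ∷ʳ _ , ()) }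
covered? []      (y ∷ S) (suc p) =
  map′ (λ (τ , h) → y ∷ʳ τ , h) (λ { (_ ∷ʳ τ , h) → τ , h }) (covered? [] S p)
covered? (c ∷ C) (y ∷ S) zero    =
  map′ (λ (c≡y , τ) → c≡y ∷ τ , tt) (λ { (c≡y ∷ τ , _) → c≡y , τ })
       (c Fin.≟ y ×-dec DecSublist._⊆?_ Fin._≟_ C S)
covered? (c ∷ C) (y ∷ S) (suc p) =
  map′ to from (c Fin.≟ y ×-dec covered? C S p ⊎-dec covered? (c ∷ C) S p)
  where
  to : (c ≡ y × Covered C S p) ⊎ Covered (c ∷ C) S p → Covered (c ∷ C) (y ∷ S) (suc p)
  to (inj₁ (c≡y , τ , h)) = c≡y ∷ τ , h
  to (inj₂ (τ , h))       = y ∷ʳ τ , h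
  from : Covered (c ∷ C) (y ∷ S) (suc p) → (c ≡ y × Covered C S p) ⊎ Covered (c ∷ C) S p
  from (c≡y ∷ τ , h) = inj₁ (c≡y , τ , h)
  from (_ ∷ʳ τ , h)  = inj₂ (τ , h)

covers? : ∀ (C S : Word k) → Dec (Covers C S)
covers? C S = all? (covered? C S ∘ toℕ)

SomeSublist : Pred (Word k) ℓ → Word k → Set ℓ
SomeSublist P S = Σ (Word _) λ C → C ⊆ S × P C

someSublist? : {P : Pred (Word k) ℓ} → Decidable P → ∀ S → Dec (SomeSublist P S)
someSublist? P? [] = map′ (λ pc → [] , [] , pc) (λ { (_ , [] , pc) → pc }) (P? [])
someSublist? {P = P} P? (y ∷ S) =
  map′ to from (someSublist? P? S ⊎-dec someSublist? (P? ∘ (y ∷_)) S)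
  where
  to : SomeSublist P S ⊎ SomeSublist (P ∘ (y ∷_)) S → SomeSublist P (y ∷ S)
  to (inj₁ (C , τ , pc)) = C , y ∷ʳ τ , pc
  to (inj₂ (C , τ , pc)) = y ∷ C , refl ∷ τ , pc
  from : SomeSublist P (y ∷ S) → SomeSublist P S ⊎ SomeSublist (P ∘ (y ∷_)) S
  from (C , _ ∷ʳ τ , pc)       = inj₁ (C , τ , pc)
  from (_ ∷ C , refl ∷ τ , pc) = inj₂ (C , τ , pc)

-- A cover of y ∷ S must occur at position 0, so only candidates y ∷ C with C ⊆ S are tried.
hasNontrivialCover? : (S : Word k) → Dec (HasNontrivialCover S)
hasNontrivialCover? []          = no λ { (_ , () , _) }
hasNontrivialCover? S@(y ∷ S′) =
  map′ to from (someSublist? (λ C → suc (length C) <? length S ×-dec covers? (y ∷ C) S) S′)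
  where
  Candidate : Word _ → Set
  Candidate C = suc (length C) < length S × Covers (y ∷ C) S
  to : SomeSublist Candidate S′ → HasNontrivialCover S
  to (C , _ , C<S , cover) = y ∷ C , C<S , cover
  from : HasNontrivialCover S → SomeSublist Candidate S′
  from (C , C<S , cover) with cover zero
  ... | refl ∷ τ , _ = _ , τ , C<S , cover

isSPrimitive? : (S : Word k) → Dec (IsSPrimitive S)
isSPrimitive? S = map′ ¬HasNontrivialCover⇒IsSPrimitive IsSPrimitive⇒¬HasNontrivialCover
                       (¬? (hasNontrivialCover? S))

Bar : Pred (Word k) ℓ → Word k → ℕ → Set ℓ
Bar P w zero    = P w
Bar P w (suc n) = P w ⊎ (∀ a → Bar P (w ++ [ a ]) n)

bar? : {P : Pred (Word k) ℓ} → Decidable P → ∀ w n → Dec (Bar P w n)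
bar? P? w zero    = P? w
bar? P? w (suc n) = P? w ⊎-dec all? λ a → bar? P? (w ++ [ a ]) n

Bar-extends : {P : Pred (Word k) ℓ} → (∀ {w} u → P w → P (w ++ u)) →
              Bar P w n → ∀ u → n ≤ length u → P (w ++ u)
Bar-extends {n = zero}  P-++ Pw        u       _         = P-++ u Pw
Bar-extends {n = suc n} P-++ (inj₁ Pw) u       _         = P-++ u Pw
Bar-extends {w = w} {n = suc n} {P = P} P-++ (inj₂ bars) (a ∷ u) (s≤s n≤u) =
  subst P (++-assoc w [ a ] u) (Bar-extends P-++ (bars a) u n≤u)

length-map-≥ : (f : Fin k → Fin n) (u : Word k) → p ≤ length u → p ≤ length (List.map f u)
length-map-≥ f u = subst (_ ≤_) (sym (length-map f u))

pattern 𝚊 = zero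
pattern 𝚋 = suc zero
pattern 𝚌 = suc (suc zero)

𝚊𝚋-bar : Bar {k = 3} HasNontrivialCover (𝚊 ∷ 𝚋 ∷ []) 7
𝚊𝚋-bar = toWitness {a? = bar? hasNontrivialCover? (𝚊 ∷ 𝚋 ∷ []) 7} tt

𝚊𝚊-nontrivial : HasNontrivialCover {k = 3} (𝚊 ∷ 𝚊 ∷ [])
𝚊𝚊-nontrivial = toWitness {a? = hasNontrivialCover? (𝚊 ∷ 𝚊 ∷ [])} tt

long-𝚊-word : ∀ b (u : Word 3) → 7 ≤ length u → HasNontrivialCover (𝚊 ∷ b ∷ u)
long-𝚊-word 𝚊 u _   = HasNontrivialCover-++ u 𝚊𝚊-nontrivial
long-𝚊-word 𝚋 u 7≤u = Bar-extends {P = HasNontrivialCover} HasNontrivialCover-++ 𝚊𝚋-bar u 7≤u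
long-𝚊-word 𝚌 u 7≤u = HasNontrivialCover-transpose⁻ 𝚋 𝚌
  (long-𝚊-word 𝚋 (List.map (transpose 𝚋 𝚌) u) (length-map-≥ _ u 7≤u))

long-word : (S : Word 3) → 9 ≤ length S → HasNontrivialCover S
long-word (𝚊 ∷ b ∷ u) (s≤s (s≤s 7≤u)) = long-𝚊-word b u 7≤u
long-word (𝚋 ∷ b ∷ u) (s≤s (s≤s 7≤u)) = HasNontrivialCover-transpose⁻ 𝚊 𝚋
  (long-𝚊-word (transpose 𝚊 𝚋 b) (List.map (transpose 𝚊 𝚋) u) (length-map-≥ _ u 7≤u))
long-word (𝚌 ∷ b ∷ u) (s≤s (s≤s 7≤u)) = HasNontrivialCover-transpose⁻ 𝚊 𝚌
  (long-𝚊-word (transpose 𝚊 𝚌 b) (List.map (transpose 𝚊 𝚌) u) (length-map-≥ _ u 7≤u))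

S₀ : Word 3
S₀ = 𝚊 ∷ 𝚋 ∷ 𝚌 ∷ 𝚊 ∷ 𝚋 ∷ 𝚊 ∷ 𝚌 ∷ 𝚋 ∷ []

fact1 : IsGamma 3 8
fact1 = (S₀ , toWitness {a? = isSPrimitive? S₀} tt , refl) ,
        λ S prim → ≮⇒≥ λ 8<S → IsSPrimitive⇒¬HasNontrivialCover prim (long-word S 8<S)
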